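{- Let $\varphi$ be a formula interpreted in team semantics (over a finite set $Prop$ of propositional variables). Then $\varphi$ is intersection closed if and only if $\varphi\otimes\varphi\models\varphi$.
   Context: A valuation is a function $v:Prop\to\{0,1\}$; a team is a set of valuations; $T\models\varphi$ denotes satisfaction. Tensor conjunction: $T\models\psi\otimes\chi$ iff there are teams $R,S\supseteq T$ with $T=R\cap S$, $R\models\psi$ and $S\models\chi$. A formula $\varphi$ is intersection closed if $S\models\varphi$ and $T\models\varphi$ imply $S\cap T\models\varphi$. $\psi\models\chi$ means every team satisfying $\psi$ satisfies $\chi$. -}

module Defs where

open import Data.Nat using (ℕ)
open import Data.Fin using (Fin)
open import Data.Bool using (Bool; true; _∧_)
open import Data.Product using (Σ; _×_; ∃; ∃-syntax)
open import Relation.Binary.PropositionalEquality using (_≡_)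

-- Prop = Fin n (a finite set of n propositional variables).
Valuation : ℕ → Set
Valuation n = Fin n → Bool

-- A team is a set of valuations; since there are finitely many valuations,
-- a set of valuations is represented by its (Boolean) characteristic function.
Team : ℕ → Set
Team n = Valuation n → Bool

_∈ₜ_ : ∀ {n} → Valuation n → Team n → Set
v ∈ₜ T = T v ≡ true

_⊆ₜ_ : ∀ {n} → Team n → Team n → Set
T ⊆ₜ R = ∀ v → v ∈ₜ T → v ∈ₜ R

_∩ₜ_ : ∀ {n} → Team n → Team n → Team n
(R ∩ₜ S) v = R v ∧ S v

_≐_ : ∀ {n} → Team n → Team n → Set
T ≐ T' = ∀ v → T v ≡ T' v

-- Since teams are sets, satisfaction only depends on the
-- team as a set (invariance under extensional equality of teams).
record TeamSemantics (n : ℕ) : Set₁ where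
  field
    Form  : Set
    _⊨_   : Team n → Form → Set
    ⊨-ext : ∀ {T T' : Team n} {φ : Form} → T ≐ T' → T ⊨ φ → T' ⊨ φ

module _ {n : ℕ} (L : TeamSemantics n) where
  open TeamSemantics L

  _⊨⊗_,_ : Team n → Form → Form → Set
  T ⊨⊗ ψ , χ = ∃[ R ] ∃[ S ] (T ⊆ₜ R × T ⊆ₜ S × T ≐ (R ∩ₜ S) × R ⊨ ψ × S ⊨ χ)

  IntersectionClosed : Form → Set
  IntersectionClosed φ = ∀ (S T : Team n) → S ⊨ φ → T ⊨ φ → (S ∩ₜ T) ⊨ φ

  TensorEntails : Form → Form → Form → Set
  TensorEntails ψ χ θ = ∀ (T : Team n) → T ⊨⊗ ψ , χ → T ⊨ θ

{-# OPTIONS --safe #-}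
module Submission where

open import Defs
open import Data.Nat using (ℕ)
open import Data.Bool.Properties using (∧-conicalˡ; ∧-conicalʳ)
open import Data.Product using (_,_)
open import Function.Bundles using (_⇔_; mk⇔)
open import Relation.Binary.PropositionalEquality using (refl; sym)

∩ₜ-⊆ˡ : ∀ {n} (R S : Team n) → (R ∩ₜ S) ⊆ₜ R
∩ₜ-⊆ˡ R S v = ∧-conicalˡ (R v) (S v)

∩ₜ-⊆ʳ : ∀ {n} (R S : Team n) → (R ∩ₜ S) ⊆ₜ S
∩ₜ-⊆ʳ R S v = ∧-conicalʳ (R v) (S v)

module _ {n : ℕ} (L : TeamSemantics n) where
  open TeamSemantics L

  ⊗-intro : ∀ {ψ χ} (R S : Team n) → R ⊨ ψ → S ⊨ χ → _⊨⊗_,_ L (R ∩ₜ S) ψ χ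
  ⊗-intro R S Rψ Sχ = R , S , ∩ₜ-⊆ˡ R S , ∩ₜ-⊆ʳ R S , (λ _ → refl) , Rψ , Sχ

  -- The side conditions R, S ⊇ T of ⊗ are redundant given T = R ∩ S.
  ⊨-∩ₜ⇔tensorEntails : ∀ ψ χ θ →
    (∀ (R S : Team n) → R ⊨ ψ → S ⊨ χ → (R ∩ₜ S) ⊨ θ) ⇔ TensorEntails L ψ χ θ
  ⊨-∩ₜ⇔tensorEntails ψ χ θ = mk⇔
    (λ ⊨-∩ₜ T (R , S , _ , _ , T≐R∩S , Rψ , Sχ) →
      ⊨-ext (λ v → sym (T≐R∩S v)) (⊨-∩ₜ R S Rψ Sχ))
    (λ entails R S Rψ Sχ → entails (R ∩ₜ S) (⊗-intro R S Rψ Sχ))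

lemma3 : (n : ℕ) (L : TeamSemantics n) (φ : TeamSemantics.Form L) →
    IntersectionClosed L φ ⇔ TensorEntails L φ φ φ
lemma3 _ L φ = ⊨-∩ₜ⇔tensorEntails L φ φ φ
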